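{- For every permutation $\pi$ (as in the context), $d(\pi)\ge\left\lfloor \frac{b(\pi)}{2}\right\rfloor$.
   Context: A permutation is $\pi=[\pi_0,\pi_1,\ldots,\pi_n,\pi_{n+1}]$ with $\pi_0=0$, $\pi_{n+1}=n+1$ and $(\pi_1,\ldots,\pi_n)$ a permutation of $\{1,\ldots,n\}$. A prefix reversal $\beta(1,j)$, $3\le j\le n+1$, gives $[\pi_0,\pi_{j-1},\ldots,\pi_1,\pi_j,\ldots,\pi_{n+1}]$. A prefix transposition $\tau(1,j,k)$, $2\le j\le n$, $j<k\le n+1$, gives $[\pi_0,\pi_j,\ldots,\pi_{k-1},\pi_1,\ldots,\pi_{j-1},\pi_k,\ldots,\pi_{n+1}]$. The identity has $\pi_i=i$ for all $i$. $d(\pi)$ is the minimum number of prefix reversals and prefix transpositions whose successive application transforms $\pi$ into the identity. Breakpoints: position $1$ is always a breakpoint; for $2\le i\le n+1$, position $i$ is a breakpoint iff $|\pi_i-\pi_{i-1}|\neq 1$. $b(\pi)$ is the number of breakpoints. -}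

module Defs where

open import Data.Nat using (ℕ; zero; suc; _+_; _≤_; _<_; _/_)
open import Data.List using (List; []; _∷_; _++_; [_]; length; reverse; take; drop; upTo; map)
open import Data.List.Relation.Binary.Permutation.Propositional using (_↭_)
open import Data.Product using (_×_; Σ; ∃; _,_)
open import Relation.Binary.PropositionalEquality using (_≡_)

-- A permutation of {1,…,n}, given by its inner entries (π₁,…,πₙ);
-- the sentinels π₀ = 0 and π_{n+1} = n+1 are implicit.
IsPerm : ℕ → List ℕ → Set
IsPerm n xs = xs ↭ map suc (upTo n)

identity : ℕ → List ℕ
identity n = map suc (upTo n)

-- Prefix reversal β(1,j) with k = j-1 the length of the reversed prefix
-- (3 ≤ j ≤ n+1  ⇔  2 ≤ k ≤ n).
prefixRev : ℕ → List ℕ → List ℕ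
prefixRev k xs = reverse (take k xs) ++ drop k xs

-- Prefix transposition τ(1,j,k) with a = j-1 (length of first block
-- π₁…π_{j-1}) and c = k-j (length of second block π_j…π_{k-1}).
-- 2 ≤ j ≤ n, j < k ≤ n+1  ⇔  1 ≤ a, 1 ≤ c, a + c ≤ n.
prefixTransp : ℕ → ℕ → List ℕ → List ℕ
prefixTransp a c xs = take c (drop a xs) ++ take a xs ++ drop (a + c) xs

data Step (n : ℕ) : List ℕ → List ℕ → Set where
  rev    : ∀ {xs} k → 2 ≤ k → k ≤ n → Step n xs (prefixRev k xs)
  transp : ∀ {xs} a c → 1 ≤ a → 1 ≤ c → a + c ≤ n →
           Step n xs (prefixTransp a c xs)

data SortsIn (n : ℕ) : List ℕ → ℕ → Set where
  done : SortsIn n (identity n) 0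
  step : ∀ {xs ys m} → Step n xs ys → SortsIn n ys m → SortsIn n xs (suc m)

open import Data.Bool using (Bool; true; false; if_then_else_; _∨_)
open import Data.Nat using (_≡ᵇ_)

adjᵇ : ℕ → ℕ → Bool
adjᵇ x y = (suc x ≡ᵇ y) ∨ (suc y ≡ᵇ x)

pairBreaks : List ℕ → ℕ
pairBreaks []           = 0
pairBreaks (x ∷ [])     = 0
pairBreaks (x ∷ y ∷ zs) = (if adjᵇ x y then 0 else 1) + pairBreaks (y ∷ zs)

-- b(π): position 1 always counts; positions i = 2,…,n+1 count iff
-- |π_i - π_{i-1}| ≠ 1, where π_{n+1} = n+1.
breakpoints : ℕ → List ℕ → ℕ
breakpoints n xs = 1 + pairBreaks (xs ++ [ suc n ])

module Submission where

-- Each breakpoint of π lies between two adjacent entries of π₁…πₙ(n+1).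
-- A prefix reversal or prefix transposition cuts this sequence into at most
-- three blocks and reassembles them, possibly reversing one; the breaks
-- inside a block are preserved (reversal does not change adjacency), so at
-- most the two new junctions can remove a break. Hence each operation
-- lowers b(π) by at most 2, and since the identity has b = 1, sorting π
-- takes at least (b(π) - 1) / 2 operations, i.e. at least ⌊b(π)/2⌋.

open import Defs
open import Data.Bool using (true; false; if_then_else_)
open import Data.Bool.Properties using (∨-comm)
open import Data.List using (List; []; _∷_; _++_; [_]; reverse; take; drop; map; upTo; applyUpTo)
open import Data.List.Properties
  using (++-assoc; ++-identityʳ; take++drop≡id; drop-drop; unfold-reverse; upTo-∷ʳ; map-++; map-upTo)
open import Data.Nat using (ℕ; zero; suc; _+_; _*_; _≤_; _/_; _≡ᵇ_; z≤n; s≤s)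
open import Data.Nat.DivMod using (m<n*o⇒m/o<n)
open import Data.Nat.Properties
open import Data.Nat.Solver using (module +-*-Solver)
open import Relation.Binary.PropositionalEquality
  using (_≡_; refl; sym; trans; cong; cong₂; subst₂; module ≡-Reasoning)

pairBreak : ℕ → ℕ → ℕ
pairBreak x y = if adjᵇ x y then 0 else 1

pairBreak≤1 : ∀ x y → pairBreak x y ≤ 1
pairBreak≤1 x y with adjᵇ x y
... | true  = z≤n
... | false = ≤-refl

pairBreak-comm : ∀ x y → pairBreak x y ≡ pairBreak y x
pairBreak-comm x y = cong (if_then 0 else 1) (∨-comm (suc x ≡ᵇ y) (suc y ≡ᵇ x))

pairBreak-suc : ∀ x → pairBreak x (suc x) ≡ 0
pairBreak-suc zero    = refl
pairBreak-suc (suc x) = pairBreak-suc x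

lastBreak : List ℕ → ℕ → ℕ
lastBreak []           y = 0
lastBreak (x ∷ [])     y = pairBreak x y
lastBreak (_ ∷ x ∷ xs) y = lastBreak (x ∷ xs) y

lastBreak≤1 : ∀ xs y → lastBreak xs y ≤ 1
lastBreak≤1 []           y = z≤n
lastBreak≤1 (x ∷ [])     y = pairBreak≤1 x y
lastBreak≤1 (_ ∷ x ∷ xs) y = lastBreak≤1 (x ∷ xs) y

lastBreak-∷ʳ : ∀ xs x y → lastBreak (xs ++ [ x ]) y ≡ pairBreak x y
lastBreak-∷ʳ []           x y = refl
lastBreak-∷ʳ (_ ∷ [])     x y = refl
lastBreak-∷ʳ (_ ∷ z ∷ zs) x y = lastBreak-∷ʳ (z ∷ zs) x y

pairBreaks-++-∷ : ∀ xs y ys →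
  pairBreaks (xs ++ y ∷ ys) ≡ pairBreaks xs + lastBreak xs y + pairBreaks (y ∷ ys)
pairBreaks-++-∷ []           y ys = refl
pairBreaks-++-∷ (_ ∷ [])     y ys = refl
pairBreaks-++-∷ (x ∷ z ∷ zs) y ys = begin
  pairBreak x z + pairBreaks (z ∷ zs ++ y ∷ ys)
    ≡⟨ cong (pairBreak x z +_) (pairBreaks-++-∷ (z ∷ zs) y ys) ⟩
  pairBreak x z + (pairBreaks (z ∷ zs) + lastBreak (z ∷ zs) y + pairBreaks (y ∷ ys))
    ≡⟨ solve 4 (λ a b c d → a :+ (b :+ c :+ d) := a :+ b :+ c :+ d) refl
         (pairBreak x z) (pairBreaks (z ∷ zs)) (lastBreak (z ∷ zs) y) (pairBreaks (y ∷ ys)) ⟩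
  pairBreak x z + pairBreaks (z ∷ zs) + lastBreak (z ∷ zs) y + pairBreaks (y ∷ ys)
    ∎
  where open ≡-Reasoning; open +-*-Solver

pairBreaks-++-≥ : ∀ xs ys → pairBreaks xs + pairBreaks ys ≤ pairBreaks (xs ++ ys)
pairBreaks-++-≥ xs [] rewrite ++-identityʳ xs | +-identityʳ (pairBreaks xs) = ≤-refl
pairBreaks-++-≥ xs (y ∷ ys) rewrite pairBreaks-++-∷ xs y ys =
  +-monoˡ-≤ (pairBreaks (y ∷ ys)) (m≤m+n (pairBreaks xs) (lastBreak xs y))

pairBreaks-++-≤ : ∀ xs ys → pairBreaks (xs ++ ys) ≤ 1 + pairBreaks xs + pairBreaks ys
pairBreaks-++-≤ xs [] rewrite ++-identityʳ xs | +-identityʳ (pairBreaks xs) = n≤1+n (pairBreaks xs)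
pairBreaks-++-≤ xs (y ∷ ys) rewrite pairBreaks-++-∷ xs y ys =
  +-monoˡ-≤ (pairBreaks (y ∷ ys)) (begin
    pairBreaks xs + lastBreak xs y ≤⟨ +-monoʳ-≤ (pairBreaks xs) (lastBreak≤1 xs y) ⟩
    pairBreaks xs + 1              ≡⟨ +-comm (pairBreaks xs) 1 ⟩
    1 + pairBreaks xs              ∎)
  where open ≤-Reasoning

pairBreaks-reverse : ∀ xs → pairBreaks (reverse xs) ≡ pairBreaks xs
pairBreaks-reverse []           = refl
pairBreaks-reverse (_ ∷ [])     = refl
pairBreaks-reverse (x ∷ y ∷ zs) = begin
  pairBreaks (reverse (x ∷ y ∷ zs))
    ≡⟨ cong pairBreaks (unfold-reverse x (y ∷ zs)) ⟩
  pairBreaks (reverse (y ∷ zs) ++ [ x ])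
    ≡⟨ pairBreaks-++-∷ (reverse (y ∷ zs)) x [] ⟩
  pairBreaks (reverse (y ∷ zs)) + lastBreak (reverse (y ∷ zs)) x + 0
    ≡⟨ +-identityʳ _ ⟩
  pairBreaks (reverse (y ∷ zs)) + lastBreak (reverse (y ∷ zs)) x
    ≡⟨ cong₂ _+_ (pairBreaks-reverse (y ∷ zs)) lastBreak-reverse ⟩
  pairBreaks (y ∷ zs) + pairBreak x y
    ≡⟨ +-comm (pairBreaks (y ∷ zs)) (pairBreak x y) ⟩
  pairBreak x y + pairBreaks (y ∷ zs)
    ∎
  where
    open ≡-Reasoning
    lastBreak-reverse : lastBreak (reverse (y ∷ zs)) x ≡ pairBreak x y
    lastBreak-reverse = begin
      lastBreak (reverse (y ∷ zs)) x     ≡⟨ cong (λ ws → lastBreak ws x) (unfold-reverse y zs) ⟩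
      lastBreak (reverse zs ++ [ y ]) x  ≡⟨ lastBreak-∷ʳ (reverse zs) y x ⟩
      pairBreak y x                      ≡⟨ pairBreak-comm y x ⟩
      pairBreak x y                      ∎

pairBreaks-reverse-prefix : ∀ xs ys → pairBreaks (xs ++ ys) ≤ 2 + pairBreaks (reverse xs ++ ys)
pairBreaks-reverse-prefix xs ys = begin
  pairBreaks (xs ++ ys)                          ≤⟨ pairBreaks-++-≤ xs ys ⟩
  1 + pairBreaks xs + pairBreaks ys              ≡⟨ cong (λ b → 1 + b + pairBreaks ys) (sym (pairBreaks-reverse xs)) ⟩
  1 + (pairBreaks (reverse xs) + pairBreaks ys)  ≤⟨ +-monoʳ-≤ 1 (pairBreaks-++-≥ (reverse xs) ys) ⟩
  1 + pairBreaks (reverse xs ++ ys)              ≤⟨ n≤1+n _ ⟩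
  2 + pairBreaks (reverse xs ++ ys)              ∎
  where open ≤-Reasoning

pairBreaks-swap-blocks : ∀ xs ys zs →
  pairBreaks (xs ++ ys ++ zs) ≤ 2 + pairBreaks (ys ++ xs ++ zs)
pairBreaks-swap-blocks xs ys zs = begin
  pairBreaks (xs ++ ys ++ zs)
    ≤⟨ pairBreaks-++-≤ xs (ys ++ zs) ⟩
  1 + pairBreaks xs + pairBreaks (ys ++ zs)
    ≤⟨ +-monoʳ-≤ (1 + pairBreaks xs) (pairBreaks-++-≤ ys zs) ⟩
  1 + pairBreaks xs + (1 + pairBreaks ys + pairBreaks zs)
    ≡⟨ solve 3 (λ a b c → con 1 :+ a :+ (con 1 :+ b :+ c) := con 2 :+ (b :+ (a :+ c))) refl
         (pairBreaks xs) (pairBreaks ys) (pairBreaks zs) ⟩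
  2 + (pairBreaks ys + (pairBreaks xs + pairBreaks zs))
    ≤⟨ +-monoʳ-≤ 2 (+-monoʳ-≤ (pairBreaks ys) (pairBreaks-++-≥ xs zs)) ⟩
  2 + (pairBreaks ys + pairBreaks (xs ++ zs))
    ≤⟨ +-monoʳ-≤ 2 (pairBreaks-++-≥ ys (xs ++ zs)) ⟩
  2 + pairBreaks (ys ++ xs ++ zs)
    ∎
  where open ≤-Reasoning; open +-*-Solver

pairBreaks-step : ∀ {n xs ys} z → Step n xs ys →
  pairBreaks (xs ++ [ z ]) ≤ 2 + pairBreaks (ys ++ [ z ])
pairBreaks-step {xs = xs} z (rev k _ _) =
  subst₂ (λ us vs → pairBreaks us ≤ 2 + pairBreaks vs)
    (trans (sym (++-assoc (take k xs) (drop k xs) [ z ])) (cong (_++ [ z ]) (take++drop≡id k xs)))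
    (sym (++-assoc (reverse (take k xs)) (drop k xs) [ z ]))
    (pairBreaks-reverse-prefix (take k xs) (drop k xs ++ [ z ]))
pairBreaks-step {xs = xs} z (transp a c _ _ _) =
  subst₂ (λ us vs → pairBreaks us ≤ 2 + pairBreaks vs)
    (begin
      A ++ C ++ D ++ [ z ]    ≡⟨ cong (A ++_) (sym (++-assoc C D [ z ])) ⟩
      A ++ (C ++ D) ++ [ z ]  ≡⟨ sym (++-assoc A (C ++ D) [ z ]) ⟩
      (A ++ C ++ D) ++ [ z ]  ≡⟨ cong (_++ [ z ]) blocks-++ ⟩
      xs ++ [ z ]             ∎)
    (begin
      C ++ A ++ D ++ [ z ]    ≡⟨ cong (C ++_) (sym (++-assoc A D [ z ])) ⟩
      C ++ (A ++ D) ++ [ z ]  ≡⟨ sym (++-assoc C (A ++ D) [ z ]) ⟩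
      (C ++ A ++ D) ++ [ z ]  ∎)
    (pairBreaks-swap-blocks A C (D ++ [ z ]))
  where
    open ≡-Reasoning
    A = take a xs
    C = take c (drop a xs)
    D = drop (a + c) xs
    blocks-++ : A ++ C ++ D ≡ xs
    blocks-++ = begin
      A ++ C ++ D                    ≡⟨ cong (λ ws → A ++ C ++ ws) (sym (drop-drop a c xs)) ⟩
      A ++ C ++ drop c (drop a xs)   ≡⟨ cong (A ++_) (take++drop≡id c (drop a xs)) ⟩
      A ++ drop a xs                 ≡⟨ take++drop≡id a xs ⟩
      xs                             ∎

pairBreaks-consecutive : ∀ (f : ℕ → ℕ) → (∀ i → f (suc i) ≡ suc (f i)) →
  ∀ m → pairBreaks (applyUpTo f m) ≡ 0
pairBreaks-consecutive f f-suc zero          = refl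
pairBreaks-consecutive f f-suc (suc zero)    = refl
pairBreaks-consecutive f f-suc (suc (suc m)) = cong₂ _+_
  (trans (cong (pairBreak (f 0)) (f-suc 0)) (pairBreak-suc (f 0)))
  (pairBreaks-consecutive (λ i → f (suc i)) (λ i → f-suc (suc i)) (suc m))

pairBreaks-identity : ∀ n → pairBreaks (identity n ++ [ suc n ]) ≡ 0
pairBreaks-identity n = begin
  pairBreaks (map suc (upTo n) ++ map suc [ n ]) ≡⟨ cong pairBreaks (sym (map-++ suc (upTo n) [ n ])) ⟩
  pairBreaks (map suc (upTo n ++ [ n ]))         ≡⟨ cong (λ ws → pairBreaks (map suc ws)) (upTo-∷ʳ n) ⟩
  pairBreaks (map suc (upTo (suc n)))            ≡⟨ cong pairBreaks (map-upTo suc (suc n)) ⟩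
  pairBreaks (applyUpTo suc (suc n))             ≡⟨ pairBreaks-consecutive suc (λ _ → refl) (suc n) ⟩
  0                                              ∎
  where open ≡-Reasoning

pairBreaks-sortsIn : ∀ {n xs m} → SortsIn n xs m → pairBreaks (xs ++ [ suc n ]) ≤ m * 2
pairBreaks-sortsIn {n} done          = ≤-reflexive (pairBreaks-identity n)
pairBreaks-sortsIn {n} (step s rest) =
  ≤-trans (pairBreaks-step (suc n) s) (+-monoʳ-≤ 2 (pairBreaks-sortsIn rest))

theorem1 : (n : ℕ) (π : List ℕ) → IsPerm n π →
    (m : ℕ) → SortsIn n π m → breakpoints n π / 2 ≤ m
-- b(π) = 1 + pairBreaks ≤ 1 + 2m < 2(m + 1)
theorem1 n π _ m sorts =
  m<1+n⇒m≤n (m<n*o⇒m/o<n {n = suc m} (s≤s (s≤s (pairBreaks-sortsIn sorts))))
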